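{- Let $g(n)=\log(n)$. There exists a computable increasing sequence $(t_i)$ such that $t_i+g(t_i)<t_{i+1}$ for all sufficiently large $i$, and $$\sum_i 2^{ -g(t_i)}=\infty \quad\text{and}\quad \sum_i 2^{t_i-t_{i+1}}<\infty.$$
   Context: Logarithms are base 2, with the convention $\log(0)=0$. -}

module Defs where

open import Data.Nat using (ℕ; zero; suc; _+_; _∸_; _^_; _<_)
open import Data.Nat.Properties using (m^n≢0)
open import Data.Product using (_×_)
open import Data.Integer using (+_)
open import Data.Rational using (ℚ; _/_; 0ℚ; 1ℚ) renaming (_+_ to _+ℚ_)

-- "t + log₂ t < s" for natural t, s (log₂ real-valued, log 0 = 0),
-- written without reals: for t ≥ 1, t + log t < s ⇔ t < s ∧ t < 2^(s - t);
-- for t = 0 both sides reduce to 0 < s.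
LogLt : ℕ → ℕ → Set
LogLt t s = (t < s) × (t < 2 ^ (s ∸ t))

-- 2^{-g(t)} with g = log₂ (log 0 = 0): equals 1/t for t ≥ 1 and 1 for t = 0.
gTerm : ℕ → ℚ
gTerm zero    = 1ℚ
gTerm (suc k) = (+ 1) / suc k

negPow2 : ℕ → ℚ
negPow2 d = (+ 1) / (2 ^ d)
  where instance _ = m^n≢0 2 d

psum : (ℕ → ℚ) → ℕ → ℚ
psum f zero    = 0ℚ
psum f (suc N) = psum f N +ℚ f N

-- The sequence starts at 2 and runs through levels a = 1, 2, …; level a advances in steps of
-- 2^a from 2^(2^(a-1)) to 2^(2^a).  A term t of level a satisfies t < 2^(2^a), so log t is
-- below the gap 2^a.  Level a has fewer than 2^(2^a)/2^a terms, each adding 2^(-2^a) to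
-- Σ 2^(t_i - t_{i+1}), so it adds less than 2^-a and that sum converges.  Cut level a into
-- the dyadic blocks [2^(K-1), 2^K): a block has 2^(K-1-a) terms, each with 1/t ≥ 2^-K, so it
-- adds at least 2^-(a+1) to Σ 1/t_i; there are 2^(a-1) blocks in level a, so every level adds
-- at least 1/4 and Σ 1/t_i diverges.  Both estimates are telescoping bounds for potentials of
-- the state of a machine that enumerates the sequence.

module Submission where

open import Defs
open import Data.Nat using (ℕ; suc; _∸_; _<_; _≤_)
open import Data.Product using (∃; _×_)
open import Data.Rational using (ℚ; _/_) renaming (_≤_ to _≤ℚ_)
open import Data.Integer using (+_)

open import Data.Nat using (zero; pred; _+_; _*_; _^_; NonZero; z≤n; s≤s)
import Data.Nat.Properties as ℕ
open import Data.Nat.Tactic.RingSolver using (solve-∀)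
open import Data.Integer.Tactic.RingSolver using () renaming (solve-∀ to ℤ-solve-∀)
import Data.Integer as ℤ
import Data.Integer.Properties as ℤ
open import Data.Rational using (0ℚ; toℚᵘ) renaming (_+_ to _+ℚ_; _-_ to _-ℚ_)
import Data.Rational.Properties as ℚ
open import Data.Rational.Unnormalised as ℚᵘ using (*≤*; *≡*) renaming (_≃_ to _≃ᵘ_)
import Data.Rational.Unnormalised.Properties as ℚᵘ
open import Data.Rational.Solver using (module +-*-Solver)
open +-*-Solver using (solve; _:+_; _:-_; _:=_; con)
open import Data.Product using (_,_; proj₁)
open import Function using (_∘_)
open import Relation.Binary.PropositionalEquality

toℚᵘ-/ : ∀ n d .{{_ : NonZero d}} → toℚᵘ (+ n / d) ≃ᵘ (+ n) ℚᵘ./ d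
toℚᵘ-/ n (suc d) = ℚ.toℚᵘ-fromℚᵘ (ℚᵘ.mkℚᵘ (+ n) d)

+/-≤ : ∀ a b c d .{{_ : NonZero b}} .{{_ : NonZero d}} → a * d ≤ c * b → + a / b ≤ℚ + c / d
+/-≤ a b@(suc _) c d@(suc _) ad≤cb = ℚ.toℚᵘ-cancel-≤
  (ℚᵘ.≤-respˡ-≃ (ℚᵘ.≃-sym (toℚᵘ-/ a b)) (ℚᵘ.≤-respʳ-≃ (ℚᵘ.≃-sym (toℚᵘ-/ c d))
    (*≤* (subst₂ ℤ._≤_ (ℤ.pos-* a d) (ℤ.pos-* c b) (ℤ.+≤+ ad≤cb)))))

+/-≡ : ∀ a b c d .{{_ : NonZero b}} .{{_ : NonZero d}} → a * d ≡ c * b → + a / b ≡ + c / d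
+/-≡ a b c d ad≡cb =
  ℚ.≤-antisym (+/-≤ a b c d (ℕ.≤-reflexive ad≡cb)) (+/-≤ c d a b (ℕ.≤-reflexive (sym ad≡cb)))

+/-+ : ∀ a c d .{{_ : NonZero d}} → + a / d +ℚ + c / d ≡ + (a + c) / d
+/-+ a c d@(suc _) = ℚ.toℚᵘ-injective (begin
  toℚᵘ (+ a / d +ℚ + c / d)              ≈⟨ ℚ.toℚᵘ-homo-+ (+ a / d) (+ c / d) ⟩
  toℚᵘ (+ a / d) ℚᵘ.+ toℚᵘ (+ c / d)     ≈⟨ ℚᵘ.+-cong (toℚᵘ-/ a d) (toℚᵘ-/ c d) ⟩
  (+ a ℚᵘ./ d) ℚᵘ.+ (+ c ℚᵘ./ d)         ≈⟨ *≡* (common-denominator (+ a) (+ c) (+ d)) ⟩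
  + (a + c) ℚᵘ./ d                       ≈⟨ ℚᵘ.≃-sym (toℚᵘ-/ (a + c) d) ⟩
  toℚᵘ (+ (a + c) / d)                   ∎)
  where
  open ℚᵘ.≃-Reasoning
  common-denominator : ∀ x y z → (x ℤ.* z ℤ.+ y ℤ.* z) ℤ.* z ≡ (x ℤ.+ y) ℤ.* (z ℤ.* z)
  common-denominator = ℤ-solve-∀

infix 7 _/2^_

_/2^_ : ℕ → ℕ → ℚ
n /2^ e = + n / 2 ^ e
  where instance _ = ℕ.m^n≢0 2 e

/2^-≤ : ∀ a e c f → a * 2 ^ f ≤ c * 2 ^ e → a /2^ e ≤ℚ c /2^ f
/2^-≤ a e c f = +/-≤ a (2 ^ e) c (2 ^ f) {{ℕ.m^n≢0 2 e}} {{ℕ.m^n≢0 2 f}}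

/2^-≡ : ∀ a e c f → a * 2 ^ f ≡ c * 2 ^ e → a /2^ e ≡ c /2^ f
/2^-≡ a e c f = +/-≡ a (2 ^ e) c (2 ^ f) {{ℕ.m^n≢0 2 e}} {{ℕ.m^n≢0 2 f}}

/2^-+ : ∀ a c e → a /2^ e +ℚ c /2^ e ≡ (a + c) /2^ e
/2^-+ a c e = +/-+ a c (2 ^ e) {{ℕ.m^n≢0 2 e}}

0≤/2^ : ∀ n e → 0ℚ ≤ℚ n /2^ e
0≤/2^ n e = /2^-≤ 0 0 n e z≤n

/2^≤1 : ∀ n e → n ≤ 2 ^ e → n /2^ e ≤ℚ 1 /2^ 0
/2^≤1 n e n≤2^e =
  /2^-≤ n e 1 0 (subst₂ _≤_ (sym (ℕ.*-identityʳ n)) (sym (ℕ.*-identityˡ (2 ^ e))) n≤2^e)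

0/2^≡0 : ∀ e → 0 /2^ e ≡ 0ℚ
0/2^≡0 e = /2^-≡ 0 e 0 0 refl

1/2^≤gTerm : ∀ {t} e → t ≤ 2 ^ e → 1 /2^ e ≤ℚ gTerm t
1/2^≤gTerm {zero}  e _   = /2^-≤ 1 e 1 0 (ℕ.*-monoʳ-≤ 1 (ℕ.m^n>0 2 e))
1/2^≤gTerm {suc k} e t≤2^e = +/-≤ 1 (2 ^ e) 1 (suc k) {{ℕ.m^n≢0 2 e}} (ℕ.*-monoʳ-≤ 1 t≤2^e)

suc-pred-2^ : ∀ n → suc (pred (2 ^ n)) ≡ 2 ^ n
suc-pred-2^ n = ℕ.suc-pred (2 ^ n) {{ℕ.m^n≢0 2 n}}

n≤f[n] : ∀ {f : ℕ → ℕ} → (∀ i → f i < f (suc i)) → ∀ n → n ≤ f n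
n≤f[n] f-inc zero    = z≤n
n≤f[n] f-inc (suc n) = ℕ.≤-trans (s≤s (n≤f[n] f-inc n)) (f-inc n)

module _ {Φ u : ℕ → ℚ} where

  psum-telescope : (∀ i → Φ (suc i) ≡ Φ i +ℚ u i) → ∀ N → Φ N ≡ Φ 0 +ℚ psum u N
  psum-telescope Φ-step zero    = sym (ℚ.+-identityʳ (Φ 0))
  psum-telescope Φ-step (suc N) = begin
    Φ (suc N)                      ≡⟨ Φ-step N ⟩
    Φ N +ℚ u N                     ≡⟨ cong (_+ℚ u N) (psum-telescope Φ-step N) ⟩
    Φ 0 +ℚ psum u N +ℚ u N         ≡⟨ ℚ.+-assoc (Φ 0) (psum u N) (u N) ⟩
    Φ 0 +ℚ (psum u N +ℚ u N)       ∎
    where open ≡-Reasoning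

  psum-≤-potential : (∀ i → 0ℚ ≤ℚ Φ i) → (∀ i → u i +ℚ Φ (suc i) ≤ℚ Φ i) →
                     ∀ N → psum u N ≤ℚ Φ 0
  psum-≤-potential Φ≥0 Φ-step N = begin
    psum u N              ≡⟨ ℚ.+-identityʳ (psum u N) ⟨
    psum u N +ℚ 0ℚ        ≤⟨ ℚ.+-monoʳ-≤ (psum u N) (Φ≥0 N) ⟩
    psum u N +ℚ Φ N       ≤⟨ psum+Φ≤Φ₀ N ⟩
    Φ 0                   ∎
    where
    open ℚ.≤-Reasoning
    psum+Φ≤Φ₀ : ∀ N → psum u N +ℚ Φ N ≤ℚ Φ 0
    psum+Φ≤Φ₀ zero    = ℚ.≤-reflexive (ℚ.+-identityˡ (Φ 0))
    psum+Φ≤Φ₀ (suc N) = begin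
      psum u N +ℚ u N +ℚ Φ (suc N)     ≡⟨ ℚ.+-assoc (psum u N) (u N) (Φ (suc N)) ⟩
      psum u N +ℚ (u N +ℚ Φ (suc N))   ≤⟨ ℚ.+-monoʳ-≤ (psum u N) (Φ-step N) ⟩
      psum u N +ℚ Φ N                  ≤⟨ psum+Φ≤Φ₀ N ⟩
      Φ 0                              ∎

psum-mono-≤ : ∀ {f g : ℕ → ℚ} → (∀ i → f i ≤ℚ g i) → ∀ N → psum f N ≤ℚ psum g N
psum-mono-≤ f≤g zero    = ℚ.≤-refl
psum-mono-≤ f≤g (suc N) = ℚ.+-mono-≤ (psum-mono-≤ f≤g N) (f≤g N)

-- At level a the position runs through the block [2^(K-1), 2^K), K = blockExp, in steps of
-- 2^a; stepsLeft + 1 steps remain in the current block and blocksLeft blocks follow it before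
-- the level ends at K = 2^a.  Invariant records exactly this.
record State : Set where
  constructor state
  field
    level      : ℕ
    block      : ℕ
    blocksLeft : ℕ
    stepsLeft  : ℕ
    pos        : ℕ
open State

blockExp : State → ℕ
blockExp s = suc (level s + block s)

Invariant : State → Set
Invariant (state a m q r t) = (suc (a + m) + q ≡ 2 ^ a) × (t + suc r * 2 ^ a ≡ 2 ^ suc (a + m))

step : State → State
step (state a m q       (suc r) t) = state a       m       q               r                    (t + 2 ^ a)
step (state a m (suc q) zero    t) = state a       (suc m) q               (pred (2 ^ suc m))   (t + 2 ^ a)
step (state a m zero    zero    t) = state (suc a) m       (pred (2 ^ a))  (pred (2 ^ m))       (t + 2 ^ a)

states : ℕ → State
states zero    = state 1 0 0 0 2
states (suc i) = step (states i)

seq : ℕ → ℕ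
seq i = pos (states i)

pos-step : ∀ s → pos (step s) ≡ pos s + 2 ^ level s
pos-step (state a m q       (suc r) t) = refl
pos-step (state a m (suc q) zero    t) = refl
pos-step (state a m zero    zero    t) = refl

2^m*2^[1+a]≡2^[1+a+m] : ∀ a m → 2 ^ m * 2 ^ suc a ≡ 2 ^ suc (a + m)
2^m*2^[1+a]≡2^[1+a+m] a m = begin
  2 ^ m * 2 ^ suc a    ≡⟨ ℕ.^-distribˡ-+-* 2 m (suc a) ⟨
  2 ^ (m + suc a)      ≡⟨ cong (2 ^_) (trans (ℕ.+-suc m a) (cong suc (ℕ.+-comm m a))) ⟩
  2 ^ suc (a + m)      ∎
  where open ≡-Reasoning

full-block-doubles : ∀ t g K {x} → t + 1 * g ≡ 2 ^ K → x ≡ 2 ^ K → t + g + x ≡ 2 ^ suc K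
full-block-doubles t g K block-full refl = begin
  t + g + 2 ^ K        ≡⟨ cong (λ k → t + k + 2 ^ K) (ℕ.*-identityˡ g) ⟨
  t + 1 * g + 2 ^ K    ≡⟨ cong (_+ 2 ^ K) block-full ⟩
  2 ^ K + 2 ^ K        ≡⟨ cong (λ k → 2 ^ K + k) (ℕ.+-identityʳ (2 ^ K)) ⟨
  2 ^ suc K            ∎
  where open ≡-Reasoning

step-preserves-Invariant : ∀ s → Invariant s → Invariant (step s)
step-preserves-Invariant (state a m q (suc r) t) (level-full , block-full) =
  level-full , trans (ℕ.+-assoc t (2 ^ a) (suc r * 2 ^ a)) block-full
step-preserves-Invariant (state a m (suc q) zero t) (level-full , block-full) =
  trans (next-block a m q) level-full ,
  trans (full-block-doubles t (2 ^ a) (suc (a + m)) block-full block-size)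
        (cong (λ k → 2 ^ suc k) (sym (ℕ.+-suc a m)))
  where
  next-block : ∀ a m q → suc (a + suc m) + q ≡ suc (a + m) + suc q
  next-block = solve-∀
  block-size : suc (pred (2 ^ suc m)) * 2 ^ a ≡ 2 ^ suc (a + m)
  block-size = begin
    suc (pred (2 ^ suc m)) * 2 ^ a   ≡⟨ cong (_* 2 ^ a) (suc-pred-2^ (suc m)) ⟩
    2 ^ suc m * 2 ^ a                ≡⟨ ℕ.*-comm (2 ^ suc m) (2 ^ a) ⟩
    2 ^ a * 2 ^ suc m                ≡⟨ 2^m*2^[1+a]≡2^[1+a+m] m a ⟩
    2 ^ suc (m + a)                  ≡⟨ cong (λ k → 2 ^ suc k) (ℕ.+-comm m a) ⟩
    2 ^ suc (a + m)                  ∎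
    where open ≡-Reasoning
step-preserves-Invariant (state a m zero zero t) (level-full , block-full) =
  level-count , full-block-doubles t (2 ^ a) (suc (a + m)) block-full block-size
  where
  open ≡-Reasoning
  next-level : ∀ a m p → suc (suc a + m) + p ≡ suc (a + m) + 0 + suc p
  next-level = solve-∀
  level-count : suc (suc a + m) + pred (2 ^ a) ≡ 2 ^ suc a
  level-count = begin
    suc (suc a + m) + pred (2 ^ a)         ≡⟨ next-level a m (pred (2 ^ a)) ⟩
    suc (a + m) + 0 + suc (pred (2 ^ a))   ≡⟨ cong₂ _+_ level-full (suc-pred-2^ a) ⟩
    2 ^ a + 2 ^ a                          ≡⟨ cong (λ k → 2 ^ a + k) (ℕ.+-identityʳ (2 ^ a)) ⟨
    2 ^ suc a                              ∎
  block-size : suc (pred (2 ^ m)) * 2 ^ suc a ≡ 2 ^ suc (a + m)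
  block-size = trans (cong (_* 2 ^ suc a) (suc-pred-2^ m)) (2^m*2^[1+a]≡2^[1+a+m] a m)

invariant : ∀ i → Invariant (states i)
invariant zero    = refl , refl
invariant (suc i) = step-preserves-Invariant (states i) (invariant i)

pos+gap≤2^blockExp : ∀ s → Invariant s → pos s + 2 ^ level s ≤ 2 ^ blockExp s
pos+gap≤2^blockExp (state a m q r t) (_ , block-full) =
  subst (t + 2 ^ a ≤_) block-full (ℕ.+-monoʳ-≤ t (ℕ.m≤n*m (2 ^ a) (suc r)))

blockExp≤2^level : ∀ s → Invariant s → blockExp s ≤ 2 ^ level s
blockExp≤2^level (state a m q r t) (level-full , _) =
  subst (suc (a + m) ≤_) level-full (ℕ.m≤m+n (suc (a + m)) q)

pos+gap≤2^2^level : ∀ s → Invariant s → pos s + 2 ^ level s ≤ 2 ^ 2 ^ level s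
pos+gap≤2^2^level s inv =
  ℕ.≤-trans (pos+gap≤2^blockExp s inv) (ℕ.^-monoʳ-≤ 2 (blockExp≤2^level s inv))

pos<2^2^level : ∀ s → Invariant s → pos s < 2 ^ 2 ^ level s
pos<2^2^level s inv = ℕ.<-≤-trans (ℕ.m<m+n (pos s) (ℕ.m^n>0 2 (level s))) (pos+gap≤2^2^level s inv)

step-LogLt : ∀ s → Invariant s → LogLt (pos s) (pos (step s))
step-LogLt s inv rewrite pos-step s =
  ℕ.m<m+n (pos s) (ℕ.m^n>0 2 (level s)) ,
  subst (λ d → pos s < 2 ^ d) (sym (ℕ.m+n∸m≡n (pos s) (2 ^ level s))) (pos<2^2^level s inv)

seq-LogLt : ∀ i → LogLt (seq i) (seq (suc i))
seq-LogLt i = step-LogLt (states i) (invariant i)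

seq-increasing : ∀ i → seq i < seq (suc i)
seq-increasing i = proj₁ (seq-LogLt i)

level-unbounded : ∀ n → ∃ λ N → n ≤ level (states N)
level-unbounded n = N , ℕ.≮⇒≥ λ level<n → ℕ.<-irrefl refl (begin-strict
  N                               ≤⟨ n≤f[n] seq-increasing N ⟩
  seq N                           <⟨ pos<2^2^level (states N) (invariant N) ⟩
  2 ^ 2 ^ level (states N)        ≤⟨ ℕ.^-monoʳ-≤ 2 (ℕ.^-monoʳ-≤ 2 (ℕ.<⇒≤ level<n)) ⟩
  N                               ∎)
  where
  N = 2 ^ 2 ^ n
  open ℕ.≤-Reasoning

-- From position t at level a: (2^(2^a) − t)/2^a more gaps of weight 2^(-2^a) in this level,
-- and at most 2^-a from all later levels.
gapTail : ℕ → ℕ → ℚ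
gapTail a t = (2 ^ 2 ^ a ∸ t) /2^ (2 ^ a + a) +ℚ 1 /2^ a

gapTail-nonneg : ∀ a t → 0ℚ ≤ℚ gapTail a t
gapTail-nonneg a t = ℚ.+-mono-≤ (0≤/2^ (2 ^ 2 ^ a ∸ t) (2 ^ a + a)) (0≤/2^ 1 a)

gap-weight : ∀ a → 1 /2^ 2 ^ a ≡ 2 ^ a /2^ (2 ^ a + a)
gap-weight a = /2^-≡ 1 (2 ^ a) (2 ^ a) (2 ^ a + a) (begin
  1 * 2 ^ (2 ^ a + a)     ≡⟨ ℕ.*-identityˡ _ ⟩
  2 ^ (2 ^ a + a)         ≡⟨ ℕ.^-distribˡ-+-* 2 (2 ^ a) a ⟩
  2 ^ 2 ^ a * 2 ^ a       ≡⟨ ℕ.*-comm (2 ^ 2 ^ a) (2 ^ a) ⟩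
  2 ^ a * 2 ^ 2 ^ a       ∎)
  where open ≡-Reasoning

gapTail-step : ∀ a t → t + 2 ^ a ≤ 2 ^ 2 ^ a → 1 /2^ 2 ^ a +ℚ gapTail a (t + 2 ^ a) ≡ gapTail a t
gapTail-step a t fits = begin
  1 /2^ 2 ^ a +ℚ (rest /2^ E +ℚ 1 /2^ a)      ≡⟨ ℚ.+-assoc (1 /2^ 2 ^ a) (rest /2^ E) (1 /2^ a) ⟨
  1 /2^ 2 ^ a +ℚ rest /2^ E +ℚ 1 /2^ a        ≡⟨ cong (λ x → x +ℚ rest /2^ E +ℚ 1 /2^ a) (gap-weight a) ⟩
  2 ^ a /2^ E +ℚ rest /2^ E +ℚ 1 /2^ a        ≡⟨ cong (_+ℚ 1 /2^ a) (/2^-+ (2 ^ a) rest E) ⟩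
  (2 ^ a + rest) /2^ E +ℚ 1 /2^ a             ≡⟨ cong (λ n → n /2^ E +ℚ 1 /2^ a) gap+rest ⟩
  (L ∸ t) /2^ E +ℚ 1 /2^ a                    ∎
  where
  open ≡-Reasoning
  L = 2 ^ 2 ^ a
  E = 2 ^ a + a
  rest = L ∸ (t + 2 ^ a)
  gap+rest : 2 ^ a + rest ≡ L ∸ t
  gap+rest = trans (cong (λ k → 2 ^ a + k) (sym (ℕ.∸-+-assoc L t (2 ^ a))))
                   (ℕ.m+[n∸m]≡n (ℕ.m+n≤o⇒m≤o∸n (2 ^ a) (subst (_≤ L) (ℕ.+-comm t (2 ^ a)) fits)))

gapTail≤ : ∀ a t → gapTail a t ≤ℚ 2 /2^ a
gapTail≤ a t = begin
  (L ∸ t) /2^ E +ℚ 1 /2^ a    ≤⟨ ℚ.+-monoˡ-≤ (1 /2^ a) (/2^-≤ (L ∸ t) E 1 a rest≤all) ⟩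
  1 /2^ a +ℚ 1 /2^ a          ≡⟨ /2^-+ 1 1 a ⟩
  2 /2^ a                     ∎
  where
  open ℚ.≤-Reasoning
  L = 2 ^ 2 ^ a
  E = 2 ^ a + a
  rest≤all : (L ∸ t) * 2 ^ a ≤ 1 * 2 ^ E
  rest≤all = subst ((L ∸ t) * 2 ^ a ≤_)
                   (trans (sym (ℕ.^-distribˡ-+-* 2 (2 ^ a) a)) (sym (ℕ.*-identityˡ (2 ^ E))))
                   (ℕ.*-monoˡ-≤ (2 ^ a) (ℕ.m∸n≤m L t))

gapTail-levelUp : ∀ a t t′ → t + 2 ^ a ≡ 2 ^ 2 ^ a →
                  1 /2^ 2 ^ a +ℚ gapTail (suc a) t′ ≤ℚ gapTail a t
gapTail-levelUp a t t′ level-done = begin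
  1 /2^ 2 ^ a +ℚ gapTail (suc a) t′     ≤⟨ ℚ.+-monoʳ-≤ (1 /2^ 2 ^ a) (gapTail≤ (suc a) t′) ⟩
  1 /2^ 2 ^ a +ℚ 2 /2^ suc a            ≡⟨ cong₂ _+ℚ_ (gap-weight a) (/2^-≡ 2 (suc a) 1 a (sym (ℕ.*-identityˡ _))) ⟩
  2 ^ a /2^ E +ℚ 1 /2^ a                ≡⟨ cong (λ n → n /2^ E +ℚ 1 /2^ a) last-gap ⟩
  (2 ^ 2 ^ a ∸ t) /2^ E +ℚ 1 /2^ a      ∎
  where
  open ℚ.≤-Reasoning
  E = 2 ^ a + a
  last-gap : 2 ^ a ≡ 2 ^ 2 ^ a ∸ t
  last-gap = trans (sym (ℕ.m+n∸m≡n t (2 ^ a))) (cong (_∸ t) level-done)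

step-gapTail : ∀ s → Invariant s →
               1 /2^ 2 ^ level s +ℚ gapTail (level (step s)) (pos (step s)) ≤ℚ gapTail (level s) (pos s)
step-gapTail s@(state a m q (suc r) t) inv = ℚ.≤-reflexive (gapTail-step a t (pos+gap≤2^2^level s inv))
step-gapTail s@(state a m (suc q) zero t) inv = ℚ.≤-reflexive (gapTail-step a t (pos+gap≤2^2^level s inv))
step-gapTail (state a m zero zero t) (level-full , block-full) = gapTail-levelUp a t (t + 2 ^ a) (begin
  t + 2 ^ a               ≡⟨ cong (λ k → t + k) (ℕ.*-identityˡ (2 ^ a)) ⟨
  t + 1 * 2 ^ a           ≡⟨ block-full ⟩
  2 ^ suc (a + m)         ≡⟨ cong (2 ^_) (trans (sym (ℕ.+-identityʳ (suc (a + m)))) level-full) ⟩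
  2 ^ 2 ^ a               ∎)
  where open ≡-Reasoning

gap-sum-bounded : ∀ N → psum (λ i → negPow2 (seq (suc i) ∸ seq i)) N ≤ℚ gapTail 1 2
gap-sum-bounded = psum-≤-potential (λ i → gapTail-nonneg (level (states i)) (seq i)) λ i →
  subst (λ x → x +ℚ tail (suc i) ≤ℚ tail i) (sym (gap i)) (step-gapTail (states i) (invariant i))
  where
  tail : ℕ → ℚ
  tail i = gapTail (level (states i)) (seq i)
  gap : ∀ i → negPow2 (seq (suc i) ∸ seq i) ≡ 1 /2^ 2 ^ level (states i)
  gap i = cong negPow2 (trans (cong (_∸ seq i) (pos-step (states i)))
                              (ℕ.m+n∸m≡n (seq i) (2 ^ level (states i))))

-- What the current level still owes to its 1/4 of Σ 2^-blockExp: 2^-(a+1) for each block to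
-- come and 2^-K for each step left in the current one.
harmonicDeficit : State → ℚ
harmonicDeficit (state a m q r t) = q /2^ suc a +ℚ suc r /2^ suc (a + m)

harmonicPotential : State → ℚ
harmonicPotential s = level s /2^ 2 -ℚ harmonicDeficit s

block-weight : ∀ a m → suc (pred (2 ^ m)) /2^ suc (a + m) ≡ 1 /2^ suc a
block-weight a m = /2^-≡ (suc (pred (2 ^ m))) (suc (a + m)) 1 (suc a) (begin
  suc (pred (2 ^ m)) * 2 ^ suc a   ≡⟨ cong (_* 2 ^ suc a) (suc-pred-2^ m) ⟩
  2 ^ m * 2 ^ suc a                ≡⟨ 2^m*2^[1+a]≡2^[1+a+m] a m ⟩
  2 ^ suc (a + m)                  ≡⟨ ℕ.*-identityˡ (2 ^ suc (a + m)) ⟨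
  1 * 2 ^ suc (a + m)              ∎)
  where open ≡-Reasoning

private
  x+[u+y]≡u+[x+y] : ∀ x u y → x +ℚ (u +ℚ y) ≡ u +ℚ (x +ℚ y)
  x+[u+y]≡u+[x+y] = solve 3 (λ x u y → x :+ (u :+ y) := u :+ (x :+ y)) refl

  x+q-q≡x-[0+u]+u : ∀ x q u → x +ℚ q -ℚ q ≡ x -ℚ (0ℚ +ℚ u) +ℚ u
  x+q-q≡x-[0+u]+u = solve 3 (λ x q u → x :+ q :- q := x :- (con 0ℚ :+ u) :+ u) refl

  x+y-y≡x : ∀ x y → x +ℚ y -ℚ y ≡ x
  x+y-y≡x = solve 2 (λ x y → x :+ y :- y := x) refl

  deficit-step⇒potential-step : ∀ x u {d d′} → d ≡ u +ℚ d′ → x -ℚ d′ ≡ x -ℚ d +ℚ u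
  deficit-step⇒potential-step x u {d′ = d′} refl =
    solve 3 (λ x u d′ → x :- d′ := x :- (u :+ d′) :+ u) refl x u d′

potential-step : ∀ s → harmonicPotential (step s) ≡ harmonicPotential s +ℚ 1 /2^ blockExp s
potential-step (state a m q (suc r) t) = deficit-step⇒potential-step (a /2^ 2) (1 /2^ K) deficit-drop
  where
  K = suc (a + m)
  D′ = q /2^ suc a +ℚ suc r /2^ K
  deficit-drop : q /2^ suc a +ℚ suc (suc r) /2^ K ≡ 1 /2^ K +ℚ D′
  deficit-drop = trans (cong (q /2^ suc a +ℚ_) (sym (/2^-+ 1 (suc r) K)))
                       (x+[u+y]≡u+[x+y] (q /2^ suc a) (1 /2^ K) (suc r /2^ K))
potential-step (state a m (suc q) zero t) = deficit-step⇒potential-step (a /2^ 2) (1 /2^ K) deficit-drop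
  where
  open ≡-Reasoning
  K = suc (a + m)
  D′ = q /2^ suc a +ℚ suc (pred (2 ^ suc m)) /2^ suc (a + suc m)
  deficit-drop : suc q /2^ suc a +ℚ 1 /2^ K ≡ 1 /2^ K +ℚ D′
  deficit-drop = begin
    suc q /2^ suc a +ℚ 1 /2^ K                 ≡⟨ ℚ.+-comm (suc q /2^ suc a) (1 /2^ K) ⟩
    1 /2^ K +ℚ suc q /2^ suc a                 ≡⟨ cong (λ n → 1 /2^ K +ℚ n /2^ suc a) (ℕ.+-comm 1 q) ⟩
    1 /2^ K +ℚ (q + 1) /2^ suc a               ≡⟨ cong (1 /2^ K +ℚ_) (/2^-+ q 1 (suc a)) ⟨
    1 /2^ K +ℚ (q /2^ suc a +ℚ 1 /2^ suc a)    ≡⟨ cong (λ x → 1 /2^ K +ℚ (q /2^ suc a +ℚ x)) (block-weight a (suc m)) ⟨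
    1 /2^ K +ℚ D′                              ∎
potential-step (state a m zero zero t) = begin
  suc a /2^ 2 -ℚ D′                                ≡⟨ cong₂ _-ℚ_ quarter-more new-deficit ⟩
  a /2^ 2 +ℚ 1 /2^ 2 -ℚ 1 /2^ 2                    ≡⟨ x+q-q≡x-[0+u]+u (a /2^ 2) (1 /2^ 2) (1 /2^ K) ⟩
  a /2^ 2 -ℚ (0ℚ +ℚ 1 /2^ K) +ℚ 1 /2^ K            ≡⟨ cong (λ x → a /2^ 2 -ℚ (x +ℚ 1 /2^ K) +ℚ 1 /2^ K)
                                                           (0/2^≡0 (suc a)) ⟨
  a /2^ 2 -ℚ (0 /2^ suc a +ℚ 1 /2^ K) +ℚ 1 /2^ K   ∎
  where
  open ≡-Reasoning
  K = suc (a + m)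
  D′ = pred (2 ^ a) /2^ suc (suc a) +ℚ suc (pred (2 ^ m)) /2^ suc (suc a + m)
  quarter-more : suc a /2^ 2 ≡ a /2^ 2 +ℚ 1 /2^ 2
  quarter-more = trans (cong (_/2^ 2) (ℕ.+-comm 1 a)) (sym (/2^-+ a 1 2))
  new-deficit : D′ ≡ 1 /2^ 2
  new-deficit = begin
    D′                                                  ≡⟨ cong (pred (2 ^ a) /2^ suc (suc a) +ℚ_) (block-weight (suc a) m) ⟩
    pred (2 ^ a) /2^ suc (suc a) +ℚ 1 /2^ suc (suc a)   ≡⟨ /2^-+ (pred (2 ^ a)) 1 (suc (suc a)) ⟩
    (pred (2 ^ a) + 1) /2^ suc (suc a)                  ≡⟨ cong (_/2^ suc (suc a)) (ℕ.+-comm (pred (2 ^ a)) 1) ⟩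
    suc (pred (2 ^ a)) /2^ suc (suc a)                  ≡⟨ cong (_/2^ suc (suc a)) (suc-pred-2^ a) ⟩
    2 ^ a /2^ suc (suc a)                               ≡⟨ /2^-≡ (2 ^ a) (suc (suc a)) 1 2 (quarter (2 ^ a)) ⟩
    1 /2^ 2                                             ∎
    where
    quarter : ∀ x → x * 4 ≡ 1 * (2 * (2 * x))
    quarter = solve-∀

harmonicSum≡potential : ∀ N → psum (λ i → 1 /2^ blockExp (states i)) N ≡ harmonicPotential (states N)
-- The potential of the initial state, 1/4 − 1/4, is 0ℚ by computation.
harmonicSum≡potential N =
  sym (trans (psum-telescope {Φ = harmonicPotential ∘ states} (λ i → potential-step (states i)) N)
             (ℚ.+-identityˡ _))

blocksLeft≤2^level : ∀ s → Invariant s → blocksLeft s ≤ 2 ^ level s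
blocksLeft≤2^level (state a m q r t) (level-full , _) =
  subst (q ≤_) level-full (ℕ.m≤n+m q (suc (a + m)))

stepsLeft<2^blockExp : ∀ s → Invariant s → stepsLeft s < 2 ^ blockExp s
stepsLeft<2^blockExp (state a m q r t) (_ , block-full) = begin
  suc r               ≤⟨ ℕ.m≤m*n (suc r) (2 ^ a) {{ℕ.m^n≢0 2 a}} ⟩
  suc r * 2 ^ a       ≤⟨ ℕ.m≤n+m (suc r * 2 ^ a) t ⟩
  t + suc r * 2 ^ a   ≡⟨ block-full ⟩
  2 ^ suc (a + m)     ∎
  where open ℕ.≤-Reasoning

harmonicDeficit≤2 : ∀ s → Invariant s → harmonicDeficit s ≤ℚ 2 /2^ 0
harmonicDeficit≤2 s@(state a m q r t) inv = begin
  q /2^ suc a +ℚ suc r /2^ suc (a + m)   ≤⟨ ℚ.+-mono-≤ (/2^≤1 q (suc a) blocks≤)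
                                                        (/2^≤1 (suc r) (suc (a + m)) (stepsLeft<2^blockExp s inv)) ⟩
  1 /2^ 0 +ℚ 1 /2^ 0                     ≡⟨ /2^-+ 1 1 0 ⟩
  2 /2^ 0                                ∎
  where
  open ℚ.≤-Reasoning
  blocks≤ : q ≤ 2 ^ suc a
  blocks≤ = ℕ.≤-trans (blocksLeft≤2^level s inv) (ℕ.^-monoʳ-≤ 2 (ℕ.n≤1+n a))

harmonicPotential-lower : ∀ B s → Invariant s → 4 * (B + 2) ≤ level s → B /2^ 0 ≤ℚ harmonicPotential s
harmonicPotential-lower B s inv deep = begin
  B /2^ 0                                   ≡⟨ cancel-two ⟨
  (B + 2) /2^ 0 -ℚ 2 /2^ 0                  ≤⟨ ℚ.+-mono-≤ (/2^-≤ (B + 2) 0 (level s) 2 quarter-level)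
                                                          (ℚ.neg-antimono-≤ (harmonicDeficit≤2 s inv)) ⟩
  level s /2^ 2 -ℚ harmonicDeficit s        ∎
  where
  open ℚ.≤-Reasoning
  quarter-level : (B + 2) * 4 ≤ level s * 1
  quarter-level = subst₂ _≤_ (ℕ.*-comm 4 (B + 2)) (sym (ℕ.*-identityʳ (level s))) deep
  cancel-two : (B + 2) /2^ 0 -ℚ 2 /2^ 0 ≡ B /2^ 0
  cancel-two = trans (cong (_-ℚ 2 /2^ 0) (sym (/2^-+ B 2 0))) (x+y-y≡x (B /2^ 0) (2 /2^ 0))

harmonic-sum-unbounded : ∀ (B : ℕ) → ∃ λ N → (+ B / 1) ≤ℚ psum (λ i → gTerm (seq i)) N
harmonic-sum-unbounded B with level-unbounded (4 * (B + 2))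
... | N , deep = N , (begin
  B /2^ 0                                      ≤⟨ harmonicPotential-lower B (states N) (invariant N) deep ⟩
  harmonicPotential (states N)                 ≡⟨ harmonicSum≡potential N ⟨
  psum (λ i → 1 /2^ blockExp (states i)) N     ≤⟨ psum-mono-≤ (λ i → 1/2^≤gTerm (blockExp (states i)) (pos≤2^blockExp i))
                                                               N ⟩
  psum (λ i → gTerm (seq i)) N                 ∎)
  where
  open ℚ.≤-Reasoning
  pos≤2^blockExp : ∀ i → seq i ≤ 2 ^ blockExp (states i)
  pos≤2^blockExp i = ℕ.m+n≤o⇒m≤o (seq i) (pos+gap≤2^blockExp (states i) (invariant i))

lemma3p3 : ∃ λ (t : ℕ → ℕ)
    → (∀ i → t i < t (suc i))
    × (∃ λ i₀ → ∀ i → i₀ ≤ i → LogLt (t i) (t (suc i)))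
    × (∀ (B : ℕ) → ∃ λ N → ((+ B) / 1) ≤ℚ psum (λ i → gTerm (t i)) N)
    × (∃ λ (C : ℚ) → ∀ N → psum (λ i → negPow2 (t (suc i) ∸ t i)) N ≤ℚ C)
lemma3p3 =
  seq , seq-increasing , (0 , λ i _ → seq-LogLt i) , harmonic-sum-unbounded , (gapTail 1 2 , gap-sum-bounded)
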